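{- Let $\alpha=(1+\sqrt{5})/2$ and $\beta=(1-\sqrt{5})/2$. Then for every integer $n\geq 0$, every integer $j\geq 1$, and every $x\in\mathbb{C}$, $$\sum_{k=0}^n\binom{n}{k}F_{jk}(\sqrt{5}F_j)^{n-k}B_{n-k}(x) = nF_j\bigl((\sqrt{5}x+\beta)F_j + F_{j-1}\bigr)^{n-1}$$ and $$\sum_{k=0}^n\binom{n}{k}F_{jk}(-\sqrt{5}F_j)^{n-k}B_{n-k}(x) = nF_j\bigl((\alpha-\sqrt{5}x)F_j + F_{j-1}\bigr)^{n-1}.$$
   Context: The Bernoulli polynomials $B_n(x)$ are defined by $\sum_{n\ge0}B_n(x)\frac{z^n}{n!}=\frac{ze^{xz}}{e^z-1}$ ($|z|<2\pi$). $F_n$ denotes the Fibonacci numbers: $F_0=0$, $F_1=1$, $F_n=F_{n-1}+F_{n-2}$. For $n=0$ the right-hand sides, which carry the factor $n$, are interpreted as $0$. -}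

module Defs where

open import Level using (Level)
open import Data.Nat using (ℕ; zero; suc; _∸_) renaming (_+_ to _+ℕ_)
open import Data.Nat.Combinatorics using (_C_)
open import Data.Integer using (+_; -_)
open import Data.Rational using (ℚ; _/_; 0ℚ; 1ℚ) renaming (_+_ to _+ℚ_; _*_ to _*ℚ_)
open import Data.Vec using (Vec; []; _∷_; _∷ʳ_; last; lookup)
open import Data.Fin using (Fin; fromℕ<)
open import Data.Nat using (s≤s; _≤_)
open import Data.Nat.Properties using (≤-refl)
open import Algebra.Bundles using (CommutativeRing)

fib : ℕ → ℕ
fib zero = zero
fib (suc zero) = suc zero
fib (suc (suc n)) = fib (suc n) +ℕ fib n

ℕ→ℚ : ℕ → ℚ
ℕ→ℚ n = (+ n) / 1

Σℚ : ℕ → (ℕ → ℚ) → ℚ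
Σℚ zero f = f zero
Σℚ (suc n) f = Σℚ n f +ℚ f (suc n)

-- Bernoulli numbers B_0, ..., B_n (convention B_1 = -1/2, i.e. from z/(e^z-1)),
-- via the recurrence  B_m = -1/(m+1) * sum_{k=0}^{m-1} binom(m+1,k) B_k  (m ≥ 1).
bernoulliVec : (n : ℕ) → Vec ℚ (suc n)
bernoulliVec zero = 1ℚ ∷ []
bernoulliVec (suc m) = prev ∷ʳ next
  where
  prev : Vec ℚ (suc m)
  prev = bernoulliVec m
  get : ℕ → ℚ
  get k = go k prev
    where
    go : {l : ℕ} → ℕ → Vec ℚ l → ℚ
    go _ [] = 0ℚ
    go zero (b ∷ _) = b
    go (suc i) (_ ∷ bs) = go i bs
  next : ℚ
  next = ((- (+ 1)) / (suc (suc m))) *ℚ Σℚ m (λ k → ℕ→ℚ ((suc (suc m)) C k) *ℚ get k)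

bernoulli : ℕ → ℚ
bernoulli n = last (bernoulliVec n)

-- Notions inside a commutative ring R equipped with a map φ : ℚ → R
-- (in the statement φ is required to be a ring homomorphism, i.e. R is a ℚ-algebra).
module InAlgebra {c ℓ : Level} (R : CommutativeRing c ℓ) (φ : ℚ → CommutativeRing.Carrier R) where
  open CommutativeRing R using (Carrier; _+_; _*_; 1#)

  pow : Carrier → ℕ → Carrier
  pow a zero = 1#
  pow a (suc n) = a * pow a n

  Σ≤ : ℕ → (ℕ → Carrier) → Carrier
  Σ≤ zero f = f zero
  Σ≤ (suc n) f = Σ≤ n f + f (suc n)

  nat : ℕ → Carrier
  nat n = φ (ℕ→ℚ n)

  B : ℕ → Carrier → Carrier
  B n x = Σ≤ n (λ k → nat (n C k) * φ (bernoulli k) * pow x (n ∸ k))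

  -- n * a^(n-1), interpreted as 0 for n = 0 (as in the paper)
  nPowPred : ℕ → Carrier → Carrier
  nPowPred zero a = φ 0ℚ
  nPowPred (suc m) a = nat (suc m) * pow a m

{-# OPTIONS --safe #-}
-- With α, β the roots of y² = y + 1 (so α − β = s) put c = s F_j, a = αʲ, b = βʲ.  Binet's
-- formula gives s F_{jk} = aᵏ − bᵏ and a = b + c.  Write cᵐ Bₘ(x) as the homogeneous Bernoulli
-- polynomial Bʰ(c, cx)ₘ = Σₖ C(m,k) Bₖ cᵏ (cx)ᵐ⁻ᵏ.  For the binomial convolution ⊛ of sequences,
-- the binomial theorem gives aᵏ ⊛ Bʰ(c, y) = Bʰ(c, a + y), and Σₖ C(m,k) Bₖ = Bₘ + [m = 1] gives
-- the homogeneous form Bʰ(c, c + y)ₘ − Bʰ(c, y)ₘ = m c yᵐ⁻¹ of Bₘ(x + 1) − Bₘ(x) = m xᵐ⁻¹.  Hence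
-- s times the left-hand side is Bʰ(c, a + cx)ₙ − Bʰ(c, b + cx)ₙ = n c (b + cx)ⁿ⁻¹, and
-- b + cx = (s x + β) F_j + F_{j-1}; since s² = 5 is invertible, s cancels.  The second identity
-- is the first one for −s, which exchanges α and β.

module Submission where

open import Defs
open import Level using (Level)
open import Data.Nat using (ℕ; _≤_; _∸_) renaming (_*_ to _*ℕ_)
open import Data.Nat.Combinatorics using (_C_)
open import Data.Integer using (+_)
open import Data.Rational using (ℚ; _/_)
open import Data.Rational.Properties using (+-*-rawRing)
open import Data.Product using (_×_)
open import Algebra.Bundles using (CommutativeRing)
open import Algebra.Morphism.Structures using (IsRingHomomorphism)

open import Data.Product using (_,_)
open import Data.Nat using (zero; suc; _<_; z≤n; s≤s; _!; NonZero)
import Data.Nat as ℕ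
import Data.Nat.Properties as ℕ
open import Data.Nat.Combinatorics using (nCk≡nC[n∸k]; nCn≡1; nC1≡n; k![n∸k]!∣n!)
open import Data.Nat.Combinatorics.Specification using (nCk≡n!/k![n-k]!)
open import Data.Nat.DivMod using (m/n*n≡m)
import Data.Nat.Coprimality as Coprime
open import Data.Nat.Tactic.RingSolver using (solve-∀)
open import Data.Integer using (-[1+_])
import Data.Integer as ℤ
import Data.Integer.Properties as ℤ
open import Data.Rational using (mkℚ; 0ℚ; 1ℚ; 1/_)
import Data.Rational as ℚ
import Data.Rational.Properties as ℚ
open import Data.Fin using (toℕ)
open import Data.Maybe using (map)
open import Data.Sum using (inj₁; inj₂)
open import Data.Vec using (Vec; []; _∷_; _∷ʳ_)
open import Data.Vec.Properties using (last-∷ʳ)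
open import Relation.Nullary using (dec⇒maybe)
open import Relation.Binary.PropositionalEquality as ≡ using (_≡_; cong; cong₂)
open import Algebra.Solver.Ring.AlmostCommutativeRing using (fromCommutativeRing; _-Raw-AlmostCommutative⟶_)
import Algebra.Properties.CommutativeSemiring.Binomial as Binomial
import Algebra.Properties.CommutativeSemiring.Exp as Exp
import Algebra.Properties.Ring as RingProperties
import Algebra.Definitions.RawMonoid as RawMonoid

-- Bernoulli numbers over ℚ

lookup₀ : ∀ {l} → ℕ → Vec ℚ l → ℚ
lookup₀ _       []       = 0ℚ
lookup₀ zero    (b ∷ _)  = b
lookup₀ (suc i) (_ ∷ bs) = lookup₀ i bs

lookup₀-∷ʳ : ∀ {l} k (v : Vec ℚ l) x → k < l → lookup₀ k (v ∷ʳ x) ≡ lookup₀ k v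
lookup₀-∷ʳ zero    (b ∷ v) x _         = ≡.refl
lookup₀-∷ʳ (suc k) (b ∷ v) x (s≤s k<l) = lookup₀-∷ʳ k v x k<l

lookup₀-∷ʳ-last : ∀ {l} (v : Vec ℚ l) x → lookup₀ l (v ∷ʳ x) ≡ x
lookup₀-∷ʳ-last []      x = ≡.refl
lookup₀-∷ʳ-last (b ∷ v) x = lookup₀-∷ʳ-last v x

lookup₀-bernoulliVec : ∀ m k → k ≤ m → lookup₀ k (bernoulliVec m) ≡ bernoulli k
lookup₀-bernoulliVec zero    zero z≤n = ≡.refl
lookup₀-bernoulliVec (suc m) k k≤1+m with ℕ.m≤n⇒m<n∨m≡n k≤1+m
... | inj₁ k<1+m = ≡.trans (lookup₀-∷ʳ k (bernoulliVec m) _ k<1+m) (lookup₀-bernoulliVec m k (ℕ.≤-pred k<1+m))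
... | inj₂ ≡.refl = ≡.trans (lookup₀-∷ʳ-last (bernoulliVec m) _) (≡.sym (last-∷ʳ _ (bernoulliVec m)))

Σℚ-cong : ∀ n {f g : ℕ → ℚ} → (∀ k → k ≤ n → f k ≡ g k) → Σℚ n f ≡ Σℚ n g
Σℚ-cong zero    f≡g = f≡g 0 z≤n
Σℚ-cong (suc n) f≡g = cong₂ ℚ._+_ (Σℚ-cong n λ k k≤n → f≡g k (ℕ.m≤n⇒m≤1+n k≤n)) (f≡g (suc n) ℕ.≤-refl)

-- `bernoulliVec` reads earlier values through a where-bound copy of `lookup₀` with two extra
-- parameters, which cannot be named here.  The three lemmas below leave it as a metavariable,
-- solved at each use where it is applied to distinct variables; the `with`s generalise
-- arguments so that the next use is again of this form.
private
  where-lookup≡lookup₀ : (m k : ℕ) (v : Vec ℚ (suc m)) → _ ≡ lookup₀ k v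
  where-lookup≡lookup₀′ : (m p i : ℕ) (w : Vec ℚ m) → _ ≡ lookup₀ i w
  where-lookup≡lookup₀″ : (M L p i : ℕ) (w : Vec ℚ L) → _ ≡ lookup₀ i w

bernoulli-suc : ∀ m → bernoulli (suc m) ≡
  ((ℤ.- (+ 1)) / suc (suc m)) ℚ.* Σℚ m (λ k → ℕ→ℚ (suc (suc m) C k) ℚ.* bernoulli k)
bernoulli-suc m with bernoulliVec m | lookup₀-bernoulliVec m
... | v | lookup₀-v≡bernoulli =
  ≡.trans (last-∷ʳ _ v) (cong (((ℤ.- (+ 1)) / suc (suc m)) ℚ.*_) (Σℚ-cong m λ k k≤m →
    cong (ℕ→ℚ (suc (suc m) C k) ℚ.*_) (≡.trans (where-lookup≡lookup₀ m k v) (lookup₀-v≡bernoulli k k≤m))))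

where-lookup≡lookup₀ m zero    (b ∷ bs) = ≡.refl
where-lookup≡lookup₀ m (suc i) (b ∷ bs) with suc i
... | p = where-lookup≡lookup₀′ m p i bs
where-lookup≡lookup₀′ zero    p i       []      = ≡.refl
where-lookup≡lookup₀′ (suc m) p zero    (b ∷ w) = ≡.refl
where-lookup≡lookup₀′ (suc m) p (suc i) (b ∷ w) with suc m
... | M = where-lookup≡lookup₀″ M m p i w
where-lookup≡lookup₀″ M zero    p i       []      = ≡.refl
where-lookup≡lookup₀″ M (suc L) p zero    (b ∷ w) = ≡.refl
where-lookup≡lookup₀″ M (suc L) p (suc i) (b ∷ w) = where-lookup≡lookup₀″ M L p i w

ℕ→ℚ≡mkℚ : ∀ n → ℕ→ℚ n ≡ mkℚ (+ n) 0 (Coprime.sym (Coprime.1-coprimeTo n))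
ℕ→ℚ≡mkℚ n = ℚ.normalize-coprime (Coprime.sym (Coprime.1-coprimeTo n))

ℕ→ℚ-suc : ∀ n → ℕ→ℚ (suc n) ≡ 1ℚ ℚ.+ ℕ→ℚ n
ℕ→ℚ-suc n = begin
  ℕ→ℚ (suc n)                                             ≡⟨ cong (λ i → (+ 1 ℤ.+ i) / 1) (≡.sym (ℤ.*-identityʳ (+ n))) ⟩
  1ℚ ℚ.+ mkℚ (+ n) 0 (Coprime.sym (Coprime.1-coprimeTo n)) ≡⟨ cong (1ℚ ℚ.+_) (≡.sym (ℕ→ℚ≡mkℚ n)) ⟩
  1ℚ ℚ.+ ℕ→ℚ n                                            ∎
  where open ≡.≡-Reasoning

ℕ→ℚ-suc*-1/suc : ∀ n → ℕ→ℚ (suc n) ℚ.* (-[1+ 0 ] / suc n) ≡ ℚ.- 1ℚ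
ℕ→ℚ-suc*-1/suc n = begin
  ℕ→ℚ (suc n) ℚ.* (-[1+ 0 ] / suc n)
    ≡⟨ cong₂ (λ p q → p ℚ.* ℚ.- q) (ℕ→ℚ≡mkℚ (suc n)) (ℚ.normalize-coprime (Coprime.1-coprimeTo (suc n))) ⟩
  p ℚ.* ℚ.- (1/ p)  ≡⟨ ≡.sym (ℚ.neg-distribʳ-* p (1/ p)) ⟩
  ℚ.- (p ℚ.* 1/ p)  ≡⟨ cong ℚ.-_ (ℚ.*-inverseʳ p) ⟩
  ℚ.- 1ℚ            ∎
  where
  open ≡.≡-Reasoning
  p = mkℚ (+ suc n) 0 (Coprime.sym (Coprime.1-coprimeTo (suc n)))

nCk*k!*[n∸k]!≡n! : ∀ {n k} → k ≤ n → (n C k) *ℕ (k ! *ℕ (n ∸ k) !) ≡ n !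
nCk*k!*[n∸k]!≡n! {n} {k} k≤n =
  ≡.trans (cong (_*ℕ (k ! *ℕ (n ∸ k) !)) (nCk≡n!/k![n-k]! k≤n)) (m/n*n≡m {{k ℕ.!* (n ∸ k) !≢0}} (k![n∸k]!∣n! k≤n))

nC[i+l]*[i+l]Ci≡nCi*[n∸i]Cl : ∀ n i l → i ℕ.+ l ≤ n → (n C (i ℕ.+ l)) *ℕ ((i ℕ.+ l) C i) ≡ (n C i) *ℕ ((n ∸ i) C l)
nC[i+l]*[i+l]Ci≡nCi*[n∸i]Cl n i l i+l≤n = ℕ.*-cancelʳ-≡ _ _ (i ! *ℕ l ! *ℕ r !) {{nonZero}} (begin
  (n C (i ℕ.+ l)) *ℕ ((i ℕ.+ l) C i) *ℕ (i ! *ℕ l ! *ℕ r !)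
    ≡⟨ regroupˡ ((n C (i ℕ.+ l))) ((i ℕ.+ l) C i) (i !) (l !) (r !) ⟩
  (n C (i ℕ.+ l)) *ℕ (((i ℕ.+ l) C i) *ℕ (i ! *ℕ l !) *ℕ r !)
    ≡⟨ cong (λ t → (n C (i ℕ.+ l)) *ℕ (((i ℕ.+ l) C i) *ℕ (i ! *ℕ t !) *ℕ r !)) (≡.sym (ℕ.m+n∸m≡n i l)) ⟩
  (n C (i ℕ.+ l)) *ℕ (((i ℕ.+ l) C i) *ℕ (i ! *ℕ (i ℕ.+ l ∸ i) !) *ℕ r !)
    ≡⟨ cong (λ t → (n C (i ℕ.+ l)) *ℕ (t *ℕ r !)) (nCk*k!*[n∸k]!≡n! (ℕ.m≤m+n i l)) ⟩
  (n C (i ℕ.+ l)) *ℕ ((i ℕ.+ l) ! *ℕ r !)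
    ≡⟨ cong (λ t → (n C (i ℕ.+ l)) *ℕ ((i ℕ.+ l) ! *ℕ t !)) (ℕ.∸-+-assoc n i l) ⟩
  (n C (i ℕ.+ l)) *ℕ ((i ℕ.+ l) ! *ℕ (n ∸ (i ℕ.+ l)) !)
    ≡⟨ nCk*k!*[n∸k]!≡n! i+l≤n ⟩
  n !
    ≡⟨ ≡.sym (nCk*k!*[n∸k]!≡n! i≤n) ⟩
  (n C i) *ℕ (i ! *ℕ (n ∸ i) !)
    ≡⟨ cong (λ t → (n C i) *ℕ (i ! *ℕ t)) (≡.sym (nCk*k!*[n∸k]!≡n! l≤n∸i)) ⟩
  (n C i) *ℕ (i ! *ℕ (((n ∸ i) C l) *ℕ (l ! *ℕ r !)))
    ≡⟨ regroupʳ (n C i) ((n ∸ i) C l) (i !) (l !) (r !) ⟩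
  (n C i) *ℕ ((n ∸ i) C l) *ℕ (i ! *ℕ l ! *ℕ r !) ∎)
  where
  open ≡.≡-Reasoning
  r = n ∸ i ∸ l
  nonZero : NonZero (i ! *ℕ l ! *ℕ r !)
  nonZero = ℕ.m*n≢0 _ _ {{i ℕ.!* l !≢0}} {{r ℕ.!≢0}}
  i≤n : i ≤ n
  i≤n = ℕ.≤-trans (ℕ.m≤m+n i l) i+l≤n
  l≤n∸i : l ≤ n ∸ i
  l≤n∸i = ≡.subst (_≤ n ∸ i) (ℕ.m+n∸m≡n i l) (ℕ.∸-monoˡ-≤ i i+l≤n)
  regroupˡ : ∀ a b c d e → a *ℕ b *ℕ (c *ℕ d *ℕ e) ≡ a *ℕ (b *ℕ (c *ℕ d) *ℕ e)
  regroupˡ = solve-∀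
  regroupʳ : ∀ a b c d e → a *ℕ (c *ℕ (b *ℕ (d *ℕ e))) ≡ a *ℕ b *ℕ (c *ℕ d *ℕ e)
  regroupʳ = solve-∀

module ℚ-Algebra {r ℓ : Level} (R : CommutativeRing r ℓ) (φ : ℚ → CommutativeRing.Carrier R)
                 (φ-hom : IsRingHomomorphism +-*-rawRing (CommutativeRing.rawRing R) φ) where

  open CommutativeRing R
  open InAlgebra R φ
  open IsRingHomomorphism φ-hom using (0#-homo; 1#-homo)
    renaming (+-homo to φ-+; *-homo to φ-*; -‿homo to φ-neg)
  open RingProperties ring using (+-cancelʳ; -1*x≈-x; -‿involutive)
  open import Algebra.Properties.CommutativeSemigroup +-commutativeSemigroup using () renaming (interchange to +-interchange)
  open Exp commutativeSemiring using (_^_; ^-congˡ; ^-homo-*; ^-assocʳ; ^-distrib-*)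
  open import Relation.Binary.Reasoning.Setoid setoid

  φ-morphism : +-*-rawRing -Raw-AlmostCommutative⟶ fromCommutativeRing R
  φ-morphism = record
    { ⟦_⟧ = φ ; +-homo = φ-+ ; *-homo = φ-* ; -‿homo = φ-neg ; 0-homo = 0#-homo ; 1-homo = 1#-homo }

  open import Algebra.Solver.Ring +-*-rawRing (fromCommutativeRing R) φ-morphism
    (λ p q → map (λ p≡q → reflexive (cong φ p≡q)) (dec⇒maybe (p ℚ.≟ q)))
    using (solve; _:=_; _:+_; _:*_; _:-_; :-_; con)

  nat1*x≈x : ∀ x → nat 1 * x ≈ x
  nat1*x≈x x = trans (*-congʳ 1#-homo) (*-identityˡ x)

  nat-suc : ∀ n → nat (suc n) ≈ 1# + nat n
  nat-suc n = trans (reflexive (cong φ (ℕ→ℚ-suc n))) (trans (φ-+ 1ℚ (ℕ→ℚ n)) (+-congʳ 1#-homo))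

  nat-+ : ∀ m n → nat (m ℕ.+ n) ≈ nat m + nat n
  nat-+ zero    n = sym (trans (+-congʳ 0#-homo) (+-identityˡ _))
  nat-+ (suc m) n = begin
    nat (suc (m ℕ.+ n))    ≈⟨ nat-suc (m ℕ.+ n) ⟩
    1# + nat (m ℕ.+ n)     ≈⟨ +-congˡ (nat-+ m n) ⟩
    1# + (nat m + nat n)   ≈⟨ +-assoc _ _ _ ⟨
    (1# + nat m) + nat n   ≈⟨ +-congʳ (nat-suc m) ⟨
    nat (suc m) + nat n    ∎

  nat-* : ∀ m n → nat (m *ℕ n) ≈ nat m * nat n
  nat-* zero    n = trans 0#-homo (sym (trans (*-congʳ 0#-homo) (zeroˡ _)))
  nat-* (suc m) n = begin
    nat (n ℕ.+ m *ℕ n)       ≈⟨ nat-+ n (m *ℕ n) ⟩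
    nat n + nat (m *ℕ n)     ≈⟨ +-congˡ (nat-* m n) ⟩
    nat n + nat m * nat n    ≈⟨ +-congʳ (*-identityˡ _) ⟨
    1# * nat n + nat m * nat n ≈⟨ distribʳ _ _ _ ⟨
    (1# + nat m) * nat n     ≈⟨ *-congʳ (nat-suc m) ⟨
    nat (suc m) * nat n      ∎

  pow≈^ : ∀ a n → pow a n ≈ a ^ n
  pow≈^ a zero    = refl
  pow≈^ a (suc n) = *-congˡ (pow≈^ a n)

  pow-1# : ∀ n → pow 1# n ≈ 1#
  pow-1# zero    = refl
  pow-1# (suc n) = trans (*-identityˡ _) (pow-1# n)

  pow-congˡ : ∀ n {a b} → a ≈ b → pow a n ≈ pow b n
  pow-congˡ n {a} {b} a≈b = trans (pow≈^ a n) (trans (^-congˡ n a≈b) (sym (pow≈^ b n)))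

  pow-+ : ∀ a m n → pow a (m ℕ.+ n) ≈ pow a m * pow a n
  pow-+ a m n = trans (pow≈^ a (m ℕ.+ n)) (trans (^-homo-* a m n) (sym (*-cong (pow≈^ a m) (pow≈^ a n))))

  pow-distrib-* : ∀ a b n → pow (a * b) n ≈ pow a n * pow b n
  pow-distrib-* a b n =
    trans (pow≈^ (a * b) n) (trans (^-distrib-* a b n) (sym (*-cong (pow≈^ a n) (pow≈^ b n))))

  pow-pow : ∀ a m n → pow (pow a m) n ≈ pow a (m *ℕ n)
  pow-pow a m n = begin
    pow (pow a m) n  ≈⟨ pow≈^ (pow a m) n ⟩
    pow a m ^ n      ≈⟨ ^-congˡ n (pow≈^ a m) ⟩
    (a ^ m) ^ n      ≈⟨ ^-assocʳ a m n ⟩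
    a ^ (m *ℕ n)     ≈⟨ pow≈^ a (m *ℕ n) ⟨
    pow a (m *ℕ n)   ∎

  nPowPred-cong : ∀ n {a b} → a ≈ b → nPowPred n a ≈ nPowPred n b
  nPowPred-cong zero    a≈b = refl
  nPowPred-cong (suc m) a≈b = *-congˡ (pow-congˡ m a≈b)

  x*0#*y≈0# : ∀ x y → x * 0# * y ≈ 0#
  x*0#*y≈0# x y = trans (*-congʳ (zeroʳ x)) (zeroˡ y)

  Σ≤-cong : ∀ n {f g : ℕ → Carrier} → (∀ k → k ≤ n → f k ≈ g k) → Σ≤ n f ≈ Σ≤ n g
  Σ≤-cong zero    f≈g = f≈g 0 z≤n
  Σ≤-cong (suc n) f≈g = +-cong (Σ≤-cong n λ k k≤n → f≈g k (ℕ.m≤n⇒m≤1+n k≤n)) (f≈g (suc n) ℕ.≤-refl)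

  Σ≤-distrib-+ : ∀ n (f g : ℕ → Carrier) → Σ≤ n (λ k → f k + g k) ≈ Σ≤ n f + Σ≤ n g
  Σ≤-distrib-+ zero    f g = refl
  Σ≤-distrib-+ (suc n) f g = trans (+-congʳ (Σ≤-distrib-+ n f g)) (+-interchange _ _ _ _)

  *-distribˡ-Σ≤ : ∀ n a (f : ℕ → Carrier) → a * Σ≤ n f ≈ Σ≤ n (λ k → a * f k)
  *-distribˡ-Σ≤ zero    a f = refl
  *-distribˡ-Σ≤ (suc n) a f = trans (distribˡ a _ _) (+-congʳ (*-distribˡ-Σ≤ n a f))

  *-distribʳ-Σ≤ : ∀ n a (f : ℕ → Carrier) → Σ≤ n f * a ≈ Σ≤ n (λ k → f k * a)
  *-distribʳ-Σ≤ zero    a f = refl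
  *-distribʳ-Σ≤ (suc n) a f = trans (distribʳ a _ _) (+-congʳ (*-distribʳ-Σ≤ n a f))

  Σ≤-zero : ∀ n (f : ℕ → Carrier) → (∀ k → k ≤ n → f k ≈ 0#) → Σ≤ n f ≈ 0#
  Σ≤-zero n f f≈0 = trans (Σ≤-cong n f≈0) (Σ≤-0# n)
    where
    Σ≤-0# : ∀ n → Σ≤ n (λ _ → 0#) ≈ 0#
    Σ≤-0# zero    = refl
    Σ≤-0# (suc n) = trans (+-identityʳ _) (Σ≤-0# n)

  Σ≤-suc : ∀ n (f : ℕ → Carrier) → Σ≤ (suc n) f ≈ f 0 + Σ≤ n (λ k → f (suc k))
  Σ≤-suc zero    f = refl
  Σ≤-suc (suc n) f = trans (+-congʳ (Σ≤-suc n f)) (+-assoc _ _ _)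

  Σ≤-reverse : ∀ n (f : ℕ → Carrier) → Σ≤ n f ≈ Σ≤ n (λ k → f (n ∸ k))
  Σ≤-reverse zero    f = refl
  Σ≤-reverse (suc n) f = begin
    Σ≤ (suc n) f                           ≈⟨ Σ≤-suc n f ⟩
    f 0 + Σ≤ n (λ k → f (suc k))           ≈⟨ +-congˡ (Σ≤-reverse n (λ k → f (suc k))) ⟩
    f 0 + Σ≤ n (λ k → f (suc (n ∸ k)))     ≈⟨ +-comm _ _ ⟩
    Σ≤ n (λ k → f (suc (n ∸ k))) + f 0     ≈⟨ +-cong (Σ≤-cong n λ k k≤n → reflexive (cong f (≡.sym (ℕ.+-∸-assoc 1 k≤n))))
                                                     (reflexive (cong f (≡.sym (ℕ.n∸n≡0 n)))) ⟩
    Σ≤ (suc n) (λ k → f (suc n ∸ k))       ∎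

  Σ≤-triangle : ∀ n (T : ℕ → ℕ → Carrier) →
    Σ≤ n (λ k → Σ≤ k (λ i → T i k)) ≈ Σ≤ n (λ i → Σ≤ (n ∸ i) (λ l → T i (i ℕ.+ l)))
  Σ≤-triangle zero    T = refl
  Σ≤-triangle (suc n) T = begin
    Σ≤ n (λ k → Σ≤ k (λ i → T i k)) + (Σ≤ n (λ i → T i (suc n)) + T (suc n) (suc n))
      ≈⟨ +-congʳ (Σ≤-triangle n T) ⟩
    Σ≤ n (λ i → Σ≤ (n ∸ i) (λ l → T i (i ℕ.+ l))) + (Σ≤ n (λ i → T i (suc n)) + T (suc n) (suc n))
      ≈⟨ +-assoc _ _ _ ⟨
    Σ≤ n (λ i → Σ≤ (n ∸ i) (λ l → T i (i ℕ.+ l))) + Σ≤ n (λ i → T i (suc n)) + T (suc n) (suc n)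
      ≈⟨ +-cong (sym (Σ≤-distrib-+ n _ _)) (reflexive (cong (T (suc n)) (≡.sym (ℕ.+-identityʳ (suc n))))) ⟩
    Σ≤ n (λ i → Σ≤ (n ∸ i) (λ l → T i (i ℕ.+ l)) + T i (suc n)) + T (suc n) (suc n ℕ.+ 0)
      ≈⟨ +-cong (Σ≤-cong n extend) (reflexive (cong (λ t → Σ≤ t (λ l → T (suc n) (suc n ℕ.+ l))) (≡.sym (ℕ.n∸n≡0 n)))) ⟩
    Σ≤ (suc n) (λ i → Σ≤ (suc n ∸ i) (λ l → T i (i ℕ.+ l))) ∎
    where
    extend : ∀ i → i ≤ n → Σ≤ (n ∸ i) (λ l → T i (i ℕ.+ l)) + T i (suc n) ≈ Σ≤ (suc n ∸ i) (λ l → T i (i ℕ.+ l))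
    extend i i≤n rewrite ℕ.+-∸-assoc 1 i≤n =
      +-congˡ (reflexive (cong (T i) (≡.sym (≡.trans (ℕ.+-suc i (n ∸ i)) (cong suc (ℕ.m+[n∸m]≡n i≤n))))))

  -- Binomial convolution

  infix  4 _≋_
  infixl 7 _⊛_

  _≋_ : (ℕ → Carrier) → (ℕ → Carrier) → Set ℓ
  f ≋ g = ∀ n → f n ≈ g n

  _⊛_ : (ℕ → Carrier) → (ℕ → Carrier) → ℕ → Carrier
  (f ⊛ g) n = Σ≤ n (λ k → nat (n C k) * f k * g (n ∸ k))

  ⊛-cong : ∀ {f f′ g g′} → f ≋ f′ → g ≋ g′ → f ⊛ g ≋ f′ ⊛ g′
  ⊛-cong f≋f′ g≋g′ n = Σ≤-cong n λ k _ → *-cong (*-congˡ (f≋f′ k)) (g≋g′ (n ∸ k))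

  ⊛-congˡ : ∀ {f f′} g → f ≋ f′ → f ⊛ g ≋ f′ ⊛ g
  ⊛-congˡ g f≋f′ = ⊛-cong {g = g} {g′ = g} f≋f′ (λ _ → refl)

  ⊛-congʳ : ∀ f {g g′} → g ≋ g′ → f ⊛ g ≋ f ⊛ g′
  ⊛-congʳ f g≋g′ = ⊛-cong {f = f} {f′ = f} (λ _ → refl) g≋g′

  ⊛-comm : ∀ f g → f ⊛ g ≋ g ⊛ f
  ⊛-comm f g n = trans (Σ≤-reverse n _) (Σ≤-cong n swap)
    where
    swap : ∀ k → k ≤ n → nat (n C (n ∸ k)) * f (n ∸ k) * g (n ∸ (n ∸ k)) ≈ nat (n C k) * g k * f (n ∸ k)
    swap k k≤n = begin
      nat (n C (n ∸ k)) * f (n ∸ k) * g (n ∸ (n ∸ k))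
        ≈⟨ *-cong (*-congʳ (reflexive (cong nat (≡.sym (nCk≡nC[n∸k] k≤n))))) (reflexive (cong g (ℕ.m∸[m∸n]≡n k≤n))) ⟩
      nat (n C k) * f (n ∸ k) * g k
        ≈⟨ solve 3 (λ a x y → a :* x :* y := a :* y :* x) refl _ _ _ ⟩
      nat (n C k) * g k * f (n ∸ k) ∎

  ⊛-distribʳ-+ : ∀ f g h → (λ k → f k + g k) ⊛ h ≋ λ n → (f ⊛ h) n + (g ⊛ h) n
  ⊛-distribʳ-+ f g h n = trans (Σ≤-cong n λ k _ → expand _ _ _ _) (Σ≤-distrib-+ n _ _)
    where
    expand : ∀ a x y z → a * (x + y) * z ≈ a * x * z + a * y * z
    expand = solve 4 (λ a x y z → a :* (x :+ y) :* z := a :* x :* z :+ a :* y :* z) refl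

  *-⊛ : ∀ a f g → (λ k → a * f k) ⊛ g ≋ λ n → a * (f ⊛ g) n
  *-⊛ a f g n = trans (Σ≤-cong n λ k _ → pull _ _ _ _) (sym (*-distribˡ-Σ≤ n a _))
    where
    pull : ∀ b a x z → b * (a * x) * z ≈ a * (b * x * z)
    pull = solve 4 (λ b a x z → b :* (a :* x) :* z := a :* (b :* x :* z)) refl

  pow-⊛-pow : ∀ c f g → (λ k → pow c k * f k) ⊛ (λ k → pow c k * g k) ≋ λ n → pow c n * (f ⊛ g) n
  pow-⊛-pow c f g n = trans (Σ≤-cong n collect) (sym (*-distribˡ-Σ≤ n (pow c n) _))
    where
    regroup : ∀ a p q x y → a * (p * x) * (q * y) ≈ (p * q) * (a * x * y)
    regroup = solve 5 (λ a p q x y → a :* (p :* x) :* (q :* y) := (p :* q) :* (a :* x :* y)) refl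
    collect : ∀ k → k ≤ n →
      nat (n C k) * (pow c k * f k) * (pow c (n ∸ k) * g (n ∸ k)) ≈ pow c n * (nat (n C k) * f k * g (n ∸ k))
    collect k k≤n =
      trans (regroup _ _ _ _ _) (*-congʳ (trans (sym (pow-+ c k (n ∸ k))) (reflexive (cong (pow c) (ℕ.m+[n∸m]≡n k≤n)))))

  ⊛-assoc : ∀ f g h → (f ⊛ g) ⊛ h ≋ f ⊛ (g ⊛ h)
  ⊛-assoc f g h n = begin
    ((f ⊛ g) ⊛ h) n
      ≈⟨ Σ≤-cong n (λ k _ → trans (*-congʳ (*-distribˡ-Σ≤ k (nat (n C k)) _)) (*-distribʳ-Σ≤ k (h (n ∸ k)) _)) ⟩
    Σ≤ n (λ k → Σ≤ k (λ i → T i k))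
      ≈⟨ Σ≤-triangle n T ⟩
    Σ≤ n (λ i → Σ≤ (n ∸ i) (λ l → T i (i ℕ.+ l)))
      ≈⟨ Σ≤-cong n (λ i i≤n → Σ≤-cong (n ∸ i) (λ l l≤n∸i → reindex i l i≤n l≤n∸i)) ⟩
    Σ≤ n (λ i → Σ≤ (n ∸ i) (λ l → nat (n C i) * f i * (nat ((n ∸ i) C l) * g l * h (n ∸ i ∸ l))))
      ≈⟨ Σ≤-cong n (λ i _ → sym (*-distribˡ-Σ≤ (n ∸ i) (nat (n C i) * f i) _)) ⟩
    (f ⊛ (g ⊛ h)) n ∎
    where
    T : ℕ → ℕ → Carrier
    T i k = nat (n C k) * (nat (k C i) * f i * g (k ∸ i)) * h (n ∸ k)
    regroup : ∀ a b x y z → a * (b * x * y) * z ≈ (a * b) * (x * y * z)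
    regroup = solve 5 (λ a b x y z → a :* (b :* x :* y) :* z := (a :* b) :* (x :* y :* z)) refl
    ungroup : ∀ a b x y z → (a * b) * (x * y * z) ≈ a * x * (b * y * z)
    ungroup = solve 5 (λ a b x y z → (a :* b) :* (x :* y :* z) := a :* x :* (b :* y :* z)) refl
    reindex : ∀ i l → i ≤ n → l ≤ n ∸ i →
      T i (i ℕ.+ l) ≈ nat (n C i) * f i * (nat ((n ∸ i) C l) * g l * h (n ∸ i ∸ l))
    reindex i l i≤n l≤n∸i = begin
      T i (i ℕ.+ l)
        ≈⟨ *-cong (*-congˡ (*-congˡ (reflexive (cong g (ℕ.m+n∸m≡n i l))))) (reflexive (cong h (≡.sym (ℕ.∸-+-assoc n i l)))) ⟩
      nat (n C (i ℕ.+ l)) * (nat ((i ℕ.+ l) C i) * f i * g l) * h (n ∸ i ∸ l)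
        ≈⟨ regroup _ _ _ _ _ ⟩
      (nat (n C (i ℕ.+ l)) * nat ((i ℕ.+ l) C i)) * (f i * g l * h (n ∸ i ∸ l))
        ≈⟨ *-congʳ choose-twice ⟩
      (nat (n C i) * nat ((n ∸ i) C l)) * (f i * g l * h (n ∸ i ∸ l))
        ≈⟨ ungroup _ _ _ _ _ ⟩
      nat (n C i) * f i * (nat ((n ∸ i) C l) * g l * h (n ∸ i ∸ l)) ∎
      where
      i+l≤n : i ℕ.+ l ≤ n
      i+l≤n = ≡.subst (i ℕ.+ l ≤_) (ℕ.m+[n∸m]≡n i≤n) (ℕ.+-monoʳ-≤ i l≤n∸i)
      choose-twice : nat (n C (i ℕ.+ l)) * nat ((i ℕ.+ l) C i) ≈ nat (n C i) * nat ((n ∸ i) C l)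
      choose-twice = begin
        nat (n C (i ℕ.+ l)) * nat ((i ℕ.+ l) C i) ≈⟨ nat-* (n C (i ℕ.+ l)) ((i ℕ.+ l) C i) ⟨
        nat ((n C (i ℕ.+ l)) *ℕ ((i ℕ.+ l) C i))  ≡⟨ cong nat (nC[i+l]*[i+l]Ci≡nCi*[n∸i]Cl n i l i+l≤n) ⟩
        nat ((n C i) *ℕ ((n ∸ i) C l))            ≈⟨ nat-* (n C i) ((n ∸ i) C l) ⟩
        nat (n C i) * nat ((n ∸ i) C l)           ∎

  binomial : ∀ a b → pow a ⊛ pow b ≋ pow (a + b)
  binomial a b n = begin
    (pow a ⊛ pow b) n
      ≈⟨ Σ≤-cong n (λ k _ → trans (*-assoc _ _ _)
           (trans (*-congˡ (*-cong (pow≈^ a k) (pow≈^ b (n ∸ k)))) (sym (·≈nat* (n C k) _)))) ⟩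
    Σ≤ n (λ k → (n C k) · (a ^ k * b ^ (n ∸ k)))
      ≈⟨ sum≈Σ≤ n _ ⟨
    binomialExpansion a b n
      ≈⟨ theorem n a b ⟨
    (a + b) ^ n
      ≈⟨ pow≈^ (a + b) n ⟨
    pow (a + b) n ∎
    where
    open Binomial commutativeSemiring using (binomialExpansion; theorem)
    open RawMonoid +-rawMonoid using (sum) renaming (_×_ to _·_)
    ·≈nat* : ∀ m x → m · x ≈ nat m * x
    ·≈nat* zero    x = sym (trans (*-congʳ 0#-homo) (zeroˡ x))
    ·≈nat* (suc m) x = begin
      x + m · x             ≈⟨ +-cong (sym (*-identityˡ x)) (·≈nat* m x) ⟩
      1# * x + nat m * x    ≈⟨ distribʳ x 1# (nat m) ⟨
      (1# + nat m) * x      ≈⟨ *-congʳ (nat-suc m) ⟨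
      nat (suc m) * x       ∎
    sum≈Σ≤ : ∀ n (g : ℕ → Carrier) → sum {suc n} (λ i → g (toℕ i)) ≈ Σ≤ n g
    sum≈Σ≤ zero    g = +-identityʳ _
    sum≈Σ≤ (suc n) g = trans (+-congˡ (sum≈Σ≤ n (λ k → g (suc k)))) (sym (Σ≤-suc n g))

  δ₁ : ℕ → Carrier
  δ₁ (suc zero) = 1#
  δ₁ _          = 0#

  δ₁-⊛-pow : ∀ y → δ₁ ⊛ pow y ≋ λ n → nPowPred n y
  δ₁-⊛-pow y zero    = trans (x*0#*y≈0# _ _) (sym 0#-homo)
  δ₁-⊛-pow y (suc m) = begin
    (δ₁ ⊛ pow y) (suc m)            ≈⟨ Σ≤-suc m t ⟩
    t 0 + Σ≤ m (λ k → t (suc k))    ≈⟨ +-cong (x*0#*y≈0# _ _) (only-t1 m) ⟩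
    0# + t 1                        ≈⟨ +-identityˡ _ ⟩
    nat (suc m C 1) * 1# * pow y m  ≈⟨ *-congʳ (trans (*-identityʳ _) (reflexive (cong nat (nC1≡n (suc m))))) ⟩
    nat (suc m) * pow y m           ∎
    where
    t : ℕ → Carrier
    t k = nat (suc m C k) * δ₁ k * pow y (suc m ∸ k)
    only-t1 : ∀ n → Σ≤ n (λ k → t (suc k)) ≈ t 1
    only-t1 zero    = refl
    only-t1 (suc n) = trans (Σ≤-suc n _) (trans (+-congˡ (Σ≤-zero n _ λ _ _ → x*0#*y≈0# _ _)) (+-identityʳ _))

  -- Bernoulli numbers and polynomials

  Bn : ℕ → Carrier
  Bn k = φ (bernoulli k)

  φ-Σℚ : ∀ n (f : ℕ → ℚ) → φ (Σℚ n f) ≈ Σ≤ n (λ k → φ (f k))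
  φ-Σℚ zero    f = refl
  φ-Σℚ (suc n) f = trans (φ-+ _ _) (+-congʳ (φ-Σℚ n f))

  Σ≤-C-Bn-vanishes : ∀ m → Σ≤ (suc m) (λ k → nat (suc (suc m) C k) * Bn k) ≈ 0#
  Σ≤-C-Bn-vanishes m = begin
    S + nat (suc (suc m) C suc m) * Bn (suc m)
      ≈⟨ +-congˡ (*-cong (reflexive (cong nat [2+m]C[1+m]≡2+m)) (reflexive (cong φ (bernoulli-suc m)))) ⟩
    S + nat (suc (suc m)) * φ (q ℚ.* Σℚ m g)
      ≈⟨ +-congˡ (*-congˡ (trans (φ-* q _) (*-congˡ (trans (φ-Σℚ m g) (Σ≤-cong m λ k _ → φ-* _ _))))) ⟩
    S + nat (suc (suc m)) * (φ q * S)
      ≈⟨ +-congˡ (*-assoc _ _ _) ⟨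
    S + φ (ℕ→ℚ (suc (suc m))) * φ q * S
      ≈⟨ +-congˡ (*-congʳ (trans (sym (φ-* _ _)) (reflexive (cong φ (ℕ→ℚ-suc*-1/suc (suc m)))))) ⟩
    S + φ (ℚ.- 1ℚ) * S
      ≈⟨ +-congˡ (trans (*-congʳ (trans (φ-neg 1ℚ) (-‿cong 1#-homo))) (-1*x≈-x S)) ⟩
    S - S
      ≈⟨ -‿inverseʳ S ⟩
    0# ∎
    where
    q = (ℤ.- (+ 1)) / suc (suc m)
    g : ℕ → ℚ
    g k = ℕ→ℚ (suc (suc m) C k) ℚ.* bernoulli k
    S = Σ≤ m (λ k → nat (suc (suc m) C k) * Bn k)
    [2+m]C[1+m]≡2+m : suc (suc m) C suc m ≡ suc (suc m)
    [2+m]C[1+m]≡2+m = ≡.trans (nCk≡nC[n∸k] (ℕ.n≤1+n (suc m))) (≡.trans (cong (suc (suc m) C_) (ℕ.m+n∸n≡m 1 m)) (nC1≡n (suc (suc m))))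

  Σ≤-C-Bn : ∀ m → Σ≤ m (λ k → nat (m C k) * Bn k) ≈ Bn m + δ₁ m
  Σ≤-C-Bn zero          = trans (nat1*x≈x _) (sym (+-identityʳ _))
  Σ≤-C-Bn (suc zero)    = trans (+-cong (trans (nat1*x≈x _) 1#-homo) (nat1*x≈x _)) (+-comm _ _)
  Σ≤-C-Bn (suc (suc m)) = begin
    Σ≤ (suc m) (λ k → nat (suc (suc m) C k) * Bn k) + nat (suc (suc m) C suc (suc m)) * Bn (suc (suc m))
      ≈⟨ +-cong (Σ≤-C-Bn-vanishes m) (trans (*-congʳ (reflexive (cong nat (nCn≡1 (suc (suc m)))))) (nat1*x≈x _)) ⟩
    0# + Bn (suc (suc m))
      ≈⟨ +-comm _ _ ⟩
    Bn (suc (suc m)) + 0# ∎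

  B-at-1# : ∀ m → B m 1# ≈ Bn m + δ₁ m
  B-at-1# m = trans (Σ≤-cong m λ k _ → trans (*-congˡ (pow-1# (m ∸ k))) (*-identityʳ _)) (Σ≤-C-Bn m)

  -- Bʰ c y n = cⁿ Bₙ(y / c) when c is invertible.
  Bʰ : Carrier → Carrier → ℕ → Carrier
  Bʰ c y = (λ k → pow c k * Bn k) ⊛ pow y

  Bʰ-congʳ : ∀ c {y y′} → y ≈ y′ → Bʰ c y ≋ Bʰ c y′
  Bʰ-congʳ c y≈y′ = ⊛-congʳ _ (λ k → pow-congˡ k y≈y′)

  pow*B≈Bʰ : ∀ c x n → pow c n * B n x ≈ Bʰ c (c * x) n
  pow*B≈Bʰ c x n = begin
    pow c n * (Bn ⊛ pow x) n                                 ≈⟨ pow-⊛-pow c Bn (pow x) n ⟨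
    ((λ k → pow c k * Bn k) ⊛ (λ k → pow c k * pow x k)) n  ≈⟨ ⊛-congʳ _ (λ k → sym (pow-distrib-* c x k)) n ⟩
    Bʰ c (c * x) n                                           ∎

  pow-⊛-Bʰ : ∀ a c y → pow a ⊛ Bʰ c y ≋ Bʰ c (a + y)
  pow-⊛-Bʰ a c y n = begin
    (pow a ⊛ (cB ⊛ pow y)) n   ≈⟨ ⊛-assoc (pow a) cB (pow y) n ⟨
    (pow a ⊛ cB ⊛ pow y) n     ≈⟨ ⊛-congˡ (pow y) (⊛-comm (pow a) cB) n ⟩
    (cB ⊛ pow a ⊛ pow y) n     ≈⟨ ⊛-assoc cB (pow a) (pow y) n ⟩
    (cB ⊛ (pow a ⊛ pow y)) n   ≈⟨ ⊛-congʳ cB (binomial a y) n ⟩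
    Bʰ c (a + y) n             ∎
    where
    cB : ℕ → Carrier
    cB k = pow c k * Bn k

  Bʰ-+ : ∀ c y → Bʰ c (c + y) ≋ λ n → Bʰ c y n + c * nPowPred n y
  Bʰ-+ c y n = begin
    Bʰ c (c + y) n                                  ≈⟨ pow-⊛-Bʰ c c y n ⟨
    (pow c ⊛ (cB ⊛ pow y)) n                        ≈⟨ ⊛-assoc (pow c) cB (pow y) n ⟨
    (pow c ⊛ cB ⊛ pow y) n                          ≈⟨ ⊛-congˡ (pow y) pow-⊛-cB n ⟩
    ((λ k → cB k + c * δ₁ k) ⊛ pow y) n             ≈⟨ ⊛-distribʳ-+ cB (λ k → c * δ₁ k) (pow y) n ⟩
    Bʰ c y n + ((λ k → c * δ₁ k) ⊛ pow y) n         ≈⟨ +-congˡ (*-⊛ c δ₁ (pow y) n) ⟩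
    Bʰ c y n + c * (δ₁ ⊛ pow y) n                   ≈⟨ +-congˡ (*-congˡ (δ₁-⊛-pow y n)) ⟩
    Bʰ c y n + c * nPowPred n y                     ∎
    where
    cB : ℕ → Carrier
    cB k = pow c k * Bn k
    pow*δ₁ : ∀ k → pow c k * δ₁ k ≈ c * δ₁ k
    pow*δ₁ zero          = trans (*-identityˡ _) (sym (zeroʳ c))
    pow*δ₁ (suc zero)    = *-congʳ (*-identityʳ c)
    pow*δ₁ (suc (suc k)) = trans (zeroʳ _) (sym (zeroʳ c))
    pow-⊛-cB : pow c ⊛ cB ≋ λ k → cB k + c * δ₁ k
    pow-⊛-cB k = begin
      (pow c ⊛ cB) k                                           ≈⟨ ⊛-congˡ cB (λ i → sym (trans (*-congˡ (pow-1# i)) (*-identityʳ _))) k ⟩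
      ((λ i → pow c i * pow 1# i) ⊛ cB) k                      ≈⟨ pow-⊛-pow c (pow 1#) Bn k ⟩
      pow c k * (pow 1# ⊛ Bn) k                                ≈⟨ *-congˡ (⊛-comm (pow 1#) Bn k) ⟩
      pow c k * B k 1#                                         ≈⟨ *-congˡ (B-at-1# k) ⟩
      pow c k * (Bn k + δ₁ k)                                  ≈⟨ distribˡ _ _ _ ⟩
      cB k + pow c k * δ₁ k                                    ≈⟨ +-congˡ (pow*δ₁ k) ⟩
      cB k + c * δ₁ k                                          ∎

  -- Fibonacci numbers and the golden ratio

  golden-pow : ∀ y → y * y ≈ y + 1# → ∀ m → pow y (suc m) ≈ y * nat (fib (suc m)) + nat (fib m)
  golden-pow y y²≈y+1 zero    = trans (*-congˡ (sym 1#-homo)) (sym (trans (+-congˡ 0#-homo) (+-identityʳ _)))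
  golden-pow y y²≈y+1 (suc m) = begin
    y * pow y (suc m)                 ≈⟨ *-congˡ (golden-pow y y²≈y+1 m) ⟩
    y * (y * F₁ + F₀)                 ≈⟨ solve 3 (λ y a b → y :* (y :* a :+ b) := y :* y :* a :+ y :* b) refl y F₁ F₀ ⟩
    y * y * F₁ + y * F₀               ≈⟨ +-congʳ (*-congʳ y²≈y+1) ⟩
    (y + 1#) * F₁ + y * F₀            ≈⟨ solve 4 (λ y u a b → (y :+ u) :* a :+ y :* b := y :* (a :+ b) :+ u :* a) refl y 1# F₁ F₀ ⟩
    y * (F₁ + F₀) + 1# * F₁           ≈⟨ +-cong (*-congˡ (sym (nat-+ (fib (suc m)) (fib m)))) (*-identityˡ F₁) ⟩
    y * nat (fib (suc (suc m))) + F₁  ∎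
    where
    F₁ = nat (fib (suc m))
    F₀ = nat (fib m)

  binet : ∀ {α β} → α * α ≈ α + 1# → β * β ≈ β + 1# → ∀ m → pow α m ≈ (α - β) * nat (fib m) + pow β m
  binet {α} {β} α²≈α+1 β²≈β+1 zero    = sym (trans (+-congʳ (trans (*-congˡ 0#-homo) (zeroʳ _))) (+-identityˡ _))
  binet {α} {β} α²≈α+1 β²≈β+1 (suc m) = begin
    pow α (suc m)                  ≈⟨ golden-pow α α²≈α+1 m ⟩
    α * F₁ + F₀                    ≈⟨ solve 4 (λ α β a b → α :* a :+ b := (α :- β) :* a :+ (β :* a :+ b)) refl α β F₁ F₀ ⟩
    (α - β) * F₁ + (β * F₁ + F₀)   ≈⟨ +-congˡ (golden-pow β β²≈β+1 m) ⟨
    (α - β) * F₁ + pow β (suc m)   ∎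
    where
    F₁ = nat (fib (suc m))
    F₀ = nat (fib m)

  ½[1+s]-golden : ∀ s → s * s ≈ φ (+ 5 / 1) →
    φ (+ 1 / 2) * (1# + s) * (φ (+ 1 / 2) * (1# + s)) ≈ φ (+ 1 / 2) * (1# + s) + 1#
  ½[1+s]-golden s s²≈5 = begin
    y * y                                      ≈⟨ *-cong y≈ y≈ ⟩
    y′ * y′                                    ≈⟨ expand s ⟩
    (y′ + φ 1ℚ) + φ (+ 1 / 4) * (s * s - φ (+ 5 / 1))
                                               ≈⟨ +-congˡ (trans (*-congˡ (trans (+-congʳ s²≈5) (-‿inverseʳ _))) (zeroʳ _)) ⟩
    (y′ + φ 1ℚ) + 0#                           ≈⟨ +-identityʳ _ ⟩
    y′ + φ 1ℚ                                  ≈⟨ +-cong (sym y≈) 1#-homo ⟩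
    y + 1#                                     ∎
    where
    y = φ (+ 1 / 2) * (1# + s)
    y′ = φ (+ 1 / 2) * (φ 1ℚ + s)
    y≈ : y ≈ y′
    y≈ = *-congˡ (+-congʳ (sym 1#-homo))
    expand : ∀ s → φ (+ 1 / 2) * (φ 1ℚ + s) * (φ (+ 1 / 2) * (φ 1ℚ + s))
                   ≈ (φ (+ 1 / 2) * (φ 1ℚ + s) + φ 1ℚ) + φ (+ 1 / 4) * (s * s - φ (+ 5 / 1))
    expand = solve 1 (λ s → con (+ 1 / 2) :* (con 1ℚ :+ s) :* (con (+ 1 / 2) :* (con 1ℚ :+ s))
                            := (con (+ 1 / 2) :* (con 1ℚ :+ s) :+ con 1ℚ) :+ con (+ 1 / 4) :* (s :* s :- con (+ 5 / 1))) refl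

  α β : Carrier → Carrier
  α s = φ (+ 1 / 2) * (1# + s)
  β s = φ (+ 1 / 2) * (1# + (- s))

  β[-s]≈α[s] : ∀ s → β (- s) ≈ α s
  β[-s]≈α[s] s = *-congˡ (+-congˡ (-‿involutive s))

  -x*-x≈x*x : ∀ x → (- x) * (- x) ≈ x * x
  -x*-x≈x*x = solve 1 (λ x → :- x :* :- x := x :* x) refl

  module _ (s : Carrier) (s²≈5 : s * s ≈ φ (+ 5 / 1)) where

    α-golden : α s * α s ≈ α s + 1#
    α-golden = ½[1+s]-golden s s²≈5

    β-golden : β s * β s ≈ β s + 1#
    β-golden = ½[1+s]-golden (- s) (trans (-x*-x≈x*x s) s²≈5)

    α-β≈s : α s - β s ≈ s
    α-β≈s = solve 2 (λ u s → con (+ 1 / 2) :* (u :+ s) :- con (+ 1 / 2) :* (u :+ :- s) := s) refl 1# s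

    s-cancel : ∀ {X Y} → s * X ≈ s * Y → X ≈ Y
    s-cancel {X} {Y} sX≈sY = begin
      X                          ≈⟨ ⅕-s-s X ⟨
      φ (+ 1 / 5) * (s * (s * X)) ≈⟨ *-congˡ (*-congˡ sX≈sY) ⟩
      φ (+ 1 / 5) * (s * (s * Y)) ≈⟨ ⅕-s-s Y ⟩
      Y                          ∎
      where
      ⅕-s-s : ∀ Z → φ (+ 1 / 5) * (s * (s * Z)) ≈ Z
      ⅕-s-s Z = begin
        φ (+ 1 / 5) * (s * (s * Z))      ≈⟨ solve 3 (λ a s Z → a :* (s :* (s :* Z)) := a :* (s :* s) :* Z) refl _ s Z ⟩
        φ (+ 1 / 5) * (s * s) * Z        ≈⟨ *-congʳ (*-congˡ s²≈5) ⟩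
        φ (+ 1 / 5) * φ (+ 5 / 1) * Z    ≈⟨ solve 1 (λ Z → con (+ 1 / 5) :* con (+ 5 / 1) :* Z := Z) refl Z ⟩
        Z                                ∎

    fibBernoulliSum : ℕ → ℕ → Carrier → Carrier
    fibBernoulliSum j n x = Σ≤ n (λ k → nat (n C k) * nat (fib (j *ℕ k)) * pow (s * nat (fib j)) (n ∸ k) * B (n ∸ k) x)

    s*fibBernoulliSum : ∀ j n x → let c = s * nat (fib j) in
      s * fibBernoulliSum j n x ≈ c * nPowPred n (pow (β s) j + c * x)
    s*fibBernoulliSum j n x = +-cancelʳ (Bʰ c y n) _ _ (begin
      s * fibBernoulliSum j n x + Bʰ c y n
        ≈⟨ +-cong (*-congˡ (Σ≤-cong n λ k _ → trans (*-assoc _ _ _) (*-congˡ (pow*B≈Bʰ c x (n ∸ k)))))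
                  (sym (pow-⊛-Bʰ b c (c * x) n)) ⟩
      s * (Fj ⊛ H) n + (pow b ⊛ H) n            ≈⟨ +-congʳ (*-⊛ s Fj H n) ⟨
      ((λ k → s * Fj k) ⊛ H) n + (pow b ⊛ H) n  ≈⟨ ⊛-distribʳ-+ (λ k → s * Fj k) (pow b) H n ⟨
      ((λ k → s * Fj k + pow b k) ⊛ H) n        ≈⟨ ⊛-congˡ H binet-jk n ⟩
      (pow a ⊛ H) n                             ≈⟨ pow-⊛-Bʰ a c (c * x) n ⟩
      Bʰ c (a + c * x) n                        ≈⟨ Bʰ-congʳ c a+cx≈c+y n ⟩
      Bʰ c (c + y) n                            ≈⟨ Bʰ-+ c y n ⟩
      Bʰ c y n + c * nPowPred n y               ≈⟨ +-comm _ _ ⟩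
      c * nPowPred n y + Bʰ c y n               ∎)
      where
      c = s * nat (fib j)
      a = pow (α s) j
      b = pow (β s) j
      y = b + c * x
      H = Bʰ c (c * x)
      Fj : ℕ → Carrier
      Fj k = nat (fib (j *ℕ k))
      binet-jk : (λ k → s * Fj k + pow b k) ≋ pow a
      binet-jk k = sym (begin
        pow a k                                   ≈⟨ pow-pow (α s) j k ⟩
        pow (α s) (j *ℕ k)                        ≈⟨ binet α-golden β-golden (j *ℕ k) ⟩
        (α s - β s) * Fj k + pow (β s) (j *ℕ k)   ≈⟨ +-cong (*-congʳ (sym α-β≈s)) (pow-pow (β s) j k) ⟨
        s * Fj k + pow b k                        ∎)
      a+cx≈c+y : a + c * x ≈ c + y
      a+cx≈c+y = begin
        a + c * x                              ≈⟨ +-congʳ (binet α-golden β-golden j) ⟩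
        (α s - β s) * nat (fib j) + b + c * x  ≈⟨ +-congʳ (+-congʳ (*-congʳ α-β≈s)) ⟩
        c + b + c * x                          ≈⟨ +-assoc c b (c * x) ⟩
        c + y                                  ∎

    fibBernoulliSum≈ : ∀ j n x → let F = nat (fib (suc j)) in
      fibBernoulliSum (suc j) n x ≈ F * nPowPred n ((s * x + β s) * F + nat (fib j))
    fibBernoulliSum≈ j n x = s-cancel (begin
      s * fibBernoulliSum (suc j) n x                     ≈⟨ s*fibBernoulliSum (suc j) n x ⟩
      s * F * nPowPred n (pow (β s) (suc j) + s * F * x)  ≈⟨ *-congˡ (nPowPred-cong n β^[1+j]+sFx≈W) ⟩
      s * F * nPowPred n W                                ≈⟨ *-assoc s F _ ⟩
      s * (F * nPowPred n W)                              ∎)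
      where
      F = nat (fib (suc j))
      W = (s * x + β s) * F + nat (fib j)
      β^[1+j]+sFx≈W : pow (β s) (suc j) + s * F * x ≈ W
      β^[1+j]+sFx≈W = begin
        pow (β s) (suc j) + s * F * x      ≈⟨ +-congʳ (golden-pow (β s) β-golden j) ⟩
        β s * F + nat (fib j) + s * F * x  ≈⟨ solve 5 (λ β F G s x → β :* F :+ G :+ s :* F :* x := (s :* x :+ β) :* F :+ G)
                                                     refl (β s) F (nat (fib j)) s x ⟩
        W                                  ∎

theorem13 : {c ℓ : Level} (R : CommutativeRing c ℓ) (φ : ℚ → CommutativeRing.Carrier R) →
    IsRingHomomorphism +-*-rawRing (CommutativeRing.rawRing R) φ →
    let open CommutativeRing R in
    let open InAlgebra R φ in
    (s : Carrier) → s * s ≈ φ ((+ 5) / 1) →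
    let α = φ ((+ 1) / 2) * (1# + s) in
    let β = φ ((+ 1) / 2) * (1# + (- s)) in
    (n j : ℕ) → 1 ≤ j → (x : Carrier) →
    (Σ≤ n (λ k → nat (n C k) * nat (fib (j *ℕ k)) * pow (s * nat (fib j)) (n ∸ k) * B (n ∸ k) x)
    ≈ nat (fib j) * nPowPred n ((s * x + β) * nat (fib j) + nat (fib (j ∸ 1))))
    × (Σ≤ n (λ k → nat (n C k) * nat (fib (j *ℕ k)) * pow ((- s) * nat (fib j)) (n ∸ k) * B (n ∸ k) x)
    ≈ nat (fib j) * nPowPred n ((α + (- (s * x))) * nat (fib j) + nat (fib (j ∸ 1))))
theorem13 R φ φ-hom s s²≈5 n (suc j) (s≤s z≤n) x =
  fibBernoulliSum≈ s s²≈5 j n x ,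
  trans (fibBernoulliSum≈ (- s) (trans (-x*-x≈x*x s) s²≈5) j n x)
        (*-congˡ (nPowPred-cong n (+-congʳ (*-congʳ -sx+β[-s]≈α[s]-sx))))
  where
  open CommutativeRing R
  open ℚ-Algebra R φ φ-hom
  open RingProperties ring using (-‿distribˡ-*)
  -sx+β[-s]≈α[s]-sx : (- s) * x + β (- s) ≈ α s - s * x
  -sx+β[-s]≈α[s]-sx = trans (+-comm _ _) (+-cong (β[-s]≈α[s] s) (sym (-‿distribˡ-* s x)))
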